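{- Let $P$ be a poset, $U\subseteq P$ and $\prec$ a pre-approximating auxiliary relation on $P$. Consider: (1) $U$ is $\prec$-open. (2) $U$ is an upper set and for every $x\in P$ such that $\bigvee s_\prec(x)$ exists and belongs to $U$, we have $s_\prec(x)\cap U\ne\emptyset$. Then (1) implies (2). If moreover $\prec$ is approximating, then (2) implies (1).
   Context: For a poset $(P,\le)$, $\mathord{\uparrow}X=\{x\mid\exists y\in X,\ y\le x\}$. A subset is directed if nonempty and every finite subset has an upper bound in it. An auxiliary relation on $P$ is a binary relation $\prec$ such that: $x\prec y$ implies $x\le y$; $u\le x\prec y\le z$ implies $u\prec z$; if $P$ has a least element $\bot$ then $\bot\prec x$ for all $x$. Write $s_\prec(x)=\{y\mid y\prec x\}$; $\prec$ is pre-approximating if every $s_\prec(x)$ is directed, approximating if moreover $\bigvee s_\prec(x)=x$ for all $x$. For $A\subseteq P$, $A^{\downarrow\prec}=\{x\in A\mid s_\prec(x)\cap A\ne\emptyset\}$. $U$ is $\prec$-open if $U=\mathord{\uparrow}U$ and $U=U^{\downarrow\prec}$. -}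

module Defs where

open import Level using (Level; _⊔_)
open import Data.Product using (Σ; ∃; _×_; _,_)
open import Data.List using (List)
open import Data.List.Relation.Unary.All using (All)
open import Relation.Unary using (Pred; _⊆_)
open import Relation.Binary using (Rel)
open import Relation.Binary.Bundles using (Poset)

module _ {c ℓ₁ ℓ₂ : Level} (P : Poset c ℓ₁ ℓ₂) where
  open Poset P

  ↑ : ∀ {ℓ} → Pred Carrier ℓ → Pred Carrier (c ⊔ ℓ ⊔ ℓ₂)
  ↑ X x = ∃ λ y → X y × y ≤ x

  _≐_ : ∀ {ℓ ℓ'} → Pred Carrier ℓ → Pred Carrier ℓ' → Set _
  A ≐ B = (A ⊆ B) × (B ⊆ A)

  IsUpperSet : ∀ {ℓ} → Pred Carrier ℓ → Set _
  IsUpperSet U = ∀ {x y} → U x → x ≤ y → U y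

  IsDirected : ∀ {ℓ} → Pred Carrier ℓ → Set _
  IsDirected D =
    (∃ λ x → D x) ×
    ((xs : List Carrier) → All D xs → ∃ λ u → D u × All (_≤ u) xs)

  IsSup : ∀ {ℓ} → Pred Carrier ℓ → Carrier → Set _
  IsSup S s = (∀ {y} → S y → y ≤ s) × (∀ u → (∀ {y} → S y → y ≤ u) → s ≤ u)

  record IsAuxiliary {ℓ₃} (_≺_ : Rel Carrier ℓ₃) : Set (c ⊔ ℓ₁ ⊔ ℓ₂ ⊔ ℓ₃) where
    field
      ≺⇒≤    : ∀ {x y} → x ≺ y → x ≤ y
      ≤≺≤⇒≺  : ∀ {u x y z} → u ≤ x → x ≺ y → y ≤ z → u ≺ z
      bottom : ∀ b → (∀ x → b ≤ x) → ∀ x → b ≺ x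

  s≺ : ∀ {ℓ₃} → Rel Carrier ℓ₃ → Carrier → Pred Carrier ℓ₃
  s≺ _≺_ x y = y ≺ x

  IsPreApproximating : ∀ {ℓ₃} → Rel Carrier ℓ₃ → Set _
  IsPreApproximating _≺_ = IsAuxiliary _≺_ × (∀ x → IsDirected (s≺ _≺_ x))

  IsApproximating : ∀ {ℓ₃} → Rel Carrier ℓ₃ → Set _
  IsApproximating _≺_ = IsPreApproximating _≺_ × (∀ x → IsSup (s≺ _≺_ x) x)

  down≺ : ∀ {ℓ₃ ℓ} → Rel Carrier ℓ₃ → Pred Carrier ℓ → Pred Carrier (c ⊔ ℓ₃ ⊔ ℓ)
  down≺ _≺_ A x = A x × (∃ λ y → s≺ _≺_ x y × A y)

  IsOpen≺ : ∀ {ℓ₃ ℓ} → Rel Carrier ℓ₃ → Pred Carrier ℓ → Set _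
  IsOpen≺ _≺_ U = (U ≐ ↑ U) × (U ≐ down≺ _≺_ U)

  Cond2 : ∀ {ℓ₃ ℓ} → Rel Carrier ℓ₃ → Pred Carrier ℓ → Set _
  Cond2 _≺_ U =
    IsUpperSet U ×
    (∀ x s → IsSup (s≺ _≺_ x) s → U s → ∃ λ y → s≺ _≺_ x y × U y)

module Submission where

open import Defs
open import Data.Product using (_×_; _,_; proj₁; ∃)
open import Relation.Unary using (Pred; _⊆_)
open import Relation.Binary using (Rel)
open import Relation.Binary.Bundles using (Poset)

module _ {c ℓ₁ ℓ₂ ℓ₃ ℓ₄} (P : Poset c ℓ₁ ℓ₂)
         {_≺_ : Rel (Poset.Carrier P) ℓ₃} {U : Pred (Poset.Carrier P) ℓ₄} where
  open Poset P

  ↑⊆⇒IsUpperSet : ↑ P U ⊆ U → IsUpperSet P U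
  ↑⊆⇒IsUpperSet ↑U⊆U {x} Ux x≤y = ↑U⊆U (x , Ux , x≤y)

  IsUpperSet⇒≐↑ : IsUpperSet P U → _≐_ P U (↑ P U)
  IsUpperSet⇒≐↑ up = (λ {x} Ux → x , Ux , refl) , λ (y , Uy , y≤x) → up Uy y≤x

  -- x is an upper bound of s≺(x), so the join s lies below x and s≺(s) ⊆ s≺(x).
  ≺-sup⇒≺ : IsAuxiliary P _≺_ → ∀ {x s} → IsSup P (s≺ P _≺_ x) s →
                   ∀ {y} → y ≺ s → y ≺ x
  ≺-sup⇒≺ aux {x} (_ , least) y≺s = ≤≺≤⇒≺ refl y≺s (least x ≺⇒≤)
    where open IsAuxiliary aux

  IsOpen≺⇒Cond2 : IsAuxiliary P _≺_ → IsOpen≺ P _≺_ U → Cond2 P _≺_ U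
  IsOpen≺⇒Cond2 aux ((_ , ↑U⊆U) , (U⊆U↓≺ , _)) = ↑⊆⇒IsUpperSet ↑U⊆U , meets
    where
    meets : ∀ x s → IsSup P (s≺ P _≺_ x) s → U s → ∃ λ y → y ≺ x × U y
    meets x s sup Us with U⊆U↓≺ Us
    ... | _ , (y , y≺s , Uy) = y , ≺-sup⇒≺ aux sup y≺s , Uy

  Cond2⇒IsOpen≺ : (∀ x → IsSup P (s≺ P _≺_ x) x) → Cond2 P _≺_ U → IsOpen≺ P _≺_ U
  Cond2⇒IsOpen≺ sup (up , meets) =
    IsUpperSet⇒≐↑ up ,
    ((λ {x} Ux → Ux , meets x x (sup x) Ux) , proj₁)

proposition3p17 : ∀ {c ℓ₁ ℓ₂ ℓ₃ ℓ₄} (P : Poset c ℓ₁ ℓ₂)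
    (_≺_ : Rel (Poset.Carrier P) ℓ₃) (U : Pred (Poset.Carrier P) ℓ₄) →
    IsPreApproximating P _≺_ →
    (IsOpen≺ P _≺_ U → Cond2 P _≺_ U) ×
    (IsApproximating P _≺_ → Cond2 P _≺_ U → IsOpen≺ P _≺_ U)
proposition3p17 P _≺_ U (aux , _) =
  IsOpen≺⇒Cond2 P aux , λ (_ , sup) → Cond2⇒IsOpen≺ P sup
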